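{- If $(B,f)\in\mathrm{Eq}(B_{\mathtt F})$ is finite and projective in $\mathrm{Eq}(B_{\mathtt F})$, then $B$ is directly indecomposable and $f(a)\cdot f(b)\neq 0$ for all non-closed atoms $a,b\in B$.
   Context: A closure algebra is a Boolean algebra with a map $f$ satisfying $f(0)=0$, $f(a+b)=f(a)+f(b)$, $a\le f(a)$, $f(f(a))\le f(a)$; $a$ is closed if $f(a)=a$. $B_{\mathtt F}$ is the complex algebra of the fork: power set of $\{u,v,w\}$ with $f(X)=\{x:\exists y\in X,\ x\mathrel Ry\}$, $R$ the reflexive closure of $\{(u,v),(u,w)\}$; $\mathrm{Eq}(B_{\mathtt F})$ is the variety of closure algebras it generates. $B$ is projective in $\mathbf V$ if for every $A\in\mathbf V$ and surjective homomorphism $p\colon A\to B$ there is a homomorphism $q\colon B\to A$ with $p\circ q=\mathrm{id}_B$. Directly indecomposable means not isomorphic to a product of two nontrivial algebras. -}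

module Defs where

open import Level using (0ℓ)
open import Data.Nat using (ℕ)
open import Data.Fin using (Fin; zero; suc)
open import Data.Bool using (Bool; true; false) renaming (_∨_ to _∨ᵇ_; _∧_ to _∧ᵇ_; not to notᵇ)
import Data.Bool.Properties as BoolP
open import Data.Product using (Σ; ∃; _×_; _,_; proj₁; proj₂)
open import Relation.Nullary using () renaming (¬_ to Not)
open import Data.Sum using (_⊎_)
open import Relation.Binary.PropositionalEquality using (_≡_; refl; cong)
open import Algebra.Lattice.Bundles using (BooleanAlgebra)

module _ (A : BooleanAlgebra 0ℓ 0ℓ) where
  open BooleanAlgebra A
  _≤ᴮ_ : Carrier → Carrier → Set
  x ≤ᴮ y = (x ∧ y) ≈ x

record ClosureAlgebra : Set₁ where
  field
    ba : BooleanAlgebra 0ℓ 0ℓ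
  open BooleanAlgebra ba public
  field
    f      : Carrier → Carrier
    f-cong : ∀ {x y} → x ≈ y → f x ≈ f y
    f-⊥    : f ⊥ ≈ ⊥
    f-∨    : ∀ x y → f (x ∨ y) ≈ (f x ∨ f y)
    f-incr : ∀ x → _≤ᴮ_ ba x (f x)
    f-idem : ∀ x → _≤ᴮ_ ba (f (f x)) (f x)

  _≤_ : Carrier → Carrier → Set
  _≤_ = _≤ᴮ_ ba

  Closed : Carrier → Set
  Closed a = f a ≈ a

  Atom : Carrier → Set
  Atom a = (Not (a ≈ ⊥)) × (∀ x → x ≤ a → (x ≈ ⊥) ⊎ (x ≈ a))

module _ (A B : BooleanAlgebra 0ℓ 0ℓ) where
  private
    module A = BooleanAlgebra A
    module B = BooleanAlgebra B

  _×ᴮ_ : BooleanAlgebra 0ℓ 0ℓ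
  _×ᴮ_ = record
    { Carrier = A.Carrier × B.Carrier
    ; _≈_ = λ x y → (proj₁ x A.≈ proj₁ y) × (proj₂ x B.≈ proj₂ y)
    ; _∨_ = λ x y → (proj₁ x A.∨ proj₁ y) , (proj₂ x B.∨ proj₂ y)
    ; _∧_ = λ x y → (proj₁ x A.∧ proj₁ y) , (proj₂ x B.∧ proj₂ y)
    ; ¬_  = λ x → (A.¬ proj₁ x) , (B.¬ proj₂ x)
    ; ⊤ = A.⊤ , B.⊤
    ; ⊥ = A.⊥ , B.⊥
    ; isBooleanAlgebra = record
      { isDistributiveLattice = record
        { isLattice = record
          { isEquivalence = record
            { refl = A.refl , B.refl
            ; sym = λ p → A.sym (proj₁ p) , B.sym (proj₂ p)
            ; trans = λ p q → A.trans (proj₁ p) (proj₁ q) , B.trans (proj₂ p) (proj₂ q) }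
          ; ∨-comm = λ x y → A.∨-comm _ _ , B.∨-comm _ _
          ; ∨-assoc = λ x y z → A.∨-assoc _ _ _ , B.∨-assoc _ _ _
          ; ∨-cong = λ p q → A.∨-cong (proj₁ p) (proj₁ q) , B.∨-cong (proj₂ p) (proj₂ q)
          ; ∧-comm = λ x y → A.∧-comm _ _ , B.∧-comm _ _
          ; ∧-assoc = λ x y z → A.∧-assoc _ _ _ , B.∧-assoc _ _ _
          ; ∧-cong = λ p q → A.∧-cong (proj₁ p) (proj₁ q) , B.∧-cong (proj₂ p) (proj₂ q)
          ; absorptive = (λ x y → A.∨-absorbs-∧ _ _ , B.∨-absorbs-∧ _ _)
                       , (λ x y → A.∧-absorbs-∨ _ _ , B.∧-absorbs-∨ _ _)
          }
        ; ∨-distrib-∧ = (λ x y z → A.∨-distribˡ-∧ _ _ _ , B.∨-distribˡ-∧ _ _ _)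
                      , (λ x y z → A.∨-distribʳ-∧ _ _ _ , B.∨-distribʳ-∧ _ _ _)
        ; ∧-distrib-∨ = (λ x y z → A.∧-distribˡ-∨ _ _ _ , B.∧-distribˡ-∨ _ _ _)
                      , (λ x y z → A.∧-distribʳ-∨ _ _ _ , B.∧-distribʳ-∨ _ _ _)
        }
      ; ∨-complement = (λ x → A.∨-complementˡ _ , B.∨-complementˡ _)
                     , (λ x → A.∨-complementʳ _ , B.∨-complementʳ _)
      ; ∧-complement = (λ x → A.∧-complementˡ _ , B.∧-complementˡ _)
                     , (λ x → A.∧-complementʳ _ , B.∧-complementʳ _)
      ; ¬-cong = λ p → A.¬-cong (proj₁ p) , B.¬-cong (proj₂ p)
      }
    }

_×ᶜ_ : ClosureAlgebra → ClosureAlgebra → ClosureAlgebra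
C ×ᶜ D = record
  { ba = ClosureAlgebra.ba C ×ᴮ ClosureAlgebra.ba D
  ; f = λ x → C.f (proj₁ x) , D.f (proj₂ x)
  ; f-cong = λ p → C.f-cong (proj₁ p) , D.f-cong (proj₂ p)
  ; f-⊥ = C.f-⊥ , D.f-⊥
  ; f-∨ = λ x y → C.f-∨ _ _ , D.f-∨ _ _
  ; f-incr = λ x → C.f-incr _ , D.f-incr _
  ; f-idem = λ x → C.f-idem _ , D.f-idem _
  }
  where
    module C = ClosureAlgebra C
    module D = ClosureAlgebra D

-- The fork algebra B_F: the complex algebra of the frame ({u,v,w}, R),
-- R = reflexive closure of {(u,v),(u,w)}.  Points u = 0, v = 1, w = 2.

Point : Set
Point = Fin 3

u v w : Point
u = zero
v = suc zero
w = suc (suc zero)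

Rᶠ : Point → Point → Bool
Rᶠ zero zero = true
Rᶠ zero (suc zero) = true
Rᶠ zero (suc (suc zero)) = true
Rᶠ (suc zero) zero = false
Rᶠ (suc zero) (suc zero) = true
Rᶠ (suc zero) (suc (suc zero)) = false
Rᶠ (suc (suc zero)) zero = false
Rᶠ (suc (suc zero)) (suc zero) = false
Rᶠ (suc (suc zero)) (suc (suc zero)) = true

⋁ : ∀ n → (Fin n → Bool) → Bool
⋁ ℕ.zero g = false
⋁ (ℕ.suc n) g = g zero ∨ᵇ ⋁ n (λ i → g (suc i))

Subset3 : Set
Subset3 = Point → Bool

fF : Subset3 → Subset3
fF X x = ⋁ 3 (λ y → Rᶠ x y ∧ᵇ X y)

𝒫₃ : BooleanAlgebra 0ℓ 0ℓ
𝒫₃ = record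
  { Carrier = Subset3
  ; _≈_ = λ X Y → ∀ i → X i ≡ Y i
  ; _∨_ = λ X Y i → X i ∨ᵇ Y i
  ; _∧_ = λ X Y i → X i ∧ᵇ Y i
  ; ¬_ = λ X i → notᵇ (X i)
  ; ⊤ = λ _ → true
  ; ⊥ = λ _ → false
  ; isBooleanAlgebra = record
    { isDistributiveLattice = record
      { isLattice = record
        { isEquivalence = record
          { refl = λ i → refl
          ; sym = λ p i → Relation.Binary.PropositionalEquality.sym (p i)
          ; trans = λ p q i → Relation.Binary.PropositionalEquality.trans (p i) (q i) }
        ; ∨-comm = λ X Y i → BoolP.∨-comm (X i) (Y i)
        ; ∨-assoc = λ X Y Z i → BoolP.∨-assoc (X i) (Y i) (Z i)
        ; ∨-cong = λ p q i → Relation.Binary.PropositionalEquality.cong₂ _∨ᵇ_ (p i) (q i)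
        ; ∧-comm = λ X Y i → BoolP.∧-comm (X i) (Y i)
        ; ∧-assoc = λ X Y Z i → BoolP.∧-assoc (X i) (Y i) (Z i)
        ; ∧-cong = λ p q i → Relation.Binary.PropositionalEquality.cong₂ _∧ᵇ_ (p i) (q i)
        ; absorptive = (λ X Y i → BoolP.∨-abs-∧ (X i) (Y i))
                     , (λ X Y i → BoolP.∧-abs-∨ (X i) (Y i))
        }
      ; ∨-distrib-∧ = (λ X Y Z i → BoolP.∨-distribˡ-∧ (X i) (Y i) (Z i))
                    , (λ X Y Z i → BoolP.∨-distribʳ-∧ (X i) (Y i) (Z i))
      ; ∧-distrib-∨ = (λ X Y Z i → BoolP.∧-distribˡ-∨ (X i) (Y i) (Z i))
                    , (λ X Y Z i → BoolP.∧-distribʳ-∨ (X i) (Y i) (Z i))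
      }
    ; ∨-complement = (λ X i → BoolP.∨-inverseˡ (X i)) , (λ X i → BoolP.∨-inverseʳ (X i))
    ; ∧-complement = (λ X i → BoolP.∧-inverseˡ (X i)) , (λ X i → BoolP.∧-inverseʳ (X i))
    ; ¬-cong = λ p i → cong notᵇ (p i)
    }
  }

module FForkFacts where
  mk : Bool → Bool → Bool → Subset3
  mk a b c zero = a
  mk a b c (suc zero) = b
  mk a b c (suc (suc zero)) = c

  _∨ₚ_ : Subset3 → Subset3 → Subset3
  (X ∨ₚ Y) i = X i ∨ᵇ Y i

  congL : ∀ {a b c d e g} i → a ≡ d → b ≡ e → c ≡ g → fF (mk a b c) i ≡ fF (mk d e g) i
  congL i refl refl refl = refl

  f⊥L : ∀ i → fF (λ _ → false) i ≡ false
  f⊥L zero = refl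
  f⊥L (suc zero) = refl
  f⊥L (suc (suc zero)) = refl

  plusL : ∀ a b c d e g i → fF (mk a b c ∨ₚ mk d e g) i ≡ (fF (mk a b c) i ∨ᵇ fF (mk d e g) i)
  plusL false false false false false false zero = refl
  plusL false false false false false false (suc zero) = refl
  plusL false false false false false false (suc (suc zero)) = refl
  plusL false false false false false true zero = refl
  plusL false false false false false true (suc zero) = refl
  plusL false false false false false true (suc (suc zero)) = refl
  plusL false false false false true false zero = refl
  plusL false false false false true false (suc zero) = refl
  plusL false false false false true false (suc (suc zero)) = refl
  plusL false false false false true true zero = refl
  plusL false false false false true true (suc zero) = refl
  plusL false false false false true true (suc (suc zero)) = refl
  plusL false false false true false false zero = refl
  plusL false false false true false false (suc zero) = refl
  plusL false false false true false false (suc (suc zero)) = refl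
  plusL false false false true false true zero = refl
  plusL false false false true false true (suc zero) = refl
  plusL false false false true false true (suc (suc zero)) = refl
  plusL false false false true true false zero = refl
  plusL false false false true true false (suc zero) = refl
  plusL false false false true true false (suc (suc zero)) = refl
  plusL false false false true true true zero = refl
  plusL false false false true true true (suc zero) = refl
  plusL false false false true true true (suc (suc zero)) = refl
  plusL false false true false false false zero = refl
  plusL false false true false false false (suc zero) = refl
  plusL false false true false false false (suc (suc zero)) = refl
  plusL false false true false false true zero = refl
  plusL false false true false false true (suc zero) = refl
  plusL false false true false false true (suc (suc zero)) = refl
  plusL false false true false true false zero = refl
  plusL false false true false true false (suc zero) = refl
  plusL false false true false true false (suc (suc zero)) = refl
  plusL false false true false true true zero = refl
  plusL false false true false true true (suc zero) = refl
  plusL false false true false true true (suc (suc zero)) = refl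
  plusL false false true true false false zero = refl
  plusL false false true true false false (suc zero) = refl
  plusL false false true true false false (suc (suc zero)) = refl
  plusL false false true true false true zero = refl
  plusL false false true true false true (suc zero) = refl
  plusL false false true true false true (suc (suc zero)) = refl
  plusL false false true true true false zero = refl
  plusL false false true true true false (suc zero) = refl
  plusL false false true true true false (suc (suc zero)) = refl
  plusL false false true true true true zero = refl
  plusL false false true true true true (suc zero) = refl
  plusL false false true true true true (suc (suc zero)) = refl
  plusL false true false false false false zero = refl
  plusL false true false false false false (suc zero) = refl
  plusL false true false false false false (suc (suc zero)) = refl
  plusL false true false false false true zero = refl
  plusL false true false false false true (suc zero) = refl
  plusL false true false false false true (suc (suc zero)) = refl
  plusL false true false false true false zero = refl
  plusL false true false false true false (suc zero) = refl
  plusL false true false false true false (suc (suc zero)) = refl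
  plusL false true false false true true zero = refl
  plusL false true false false true true (suc zero) = refl
  plusL false true false false true true (suc (suc zero)) = refl
  plusL false true false true false false zero = refl
  plusL false true false true false false (suc zero) = refl
  plusL false true false true false false (suc (suc zero)) = refl
  plusL false true false true false true zero = refl
  plusL false true false true false true (suc zero) = refl
  plusL false true false true false true (suc (suc zero)) = refl
  plusL false true false true true false zero = refl
  plusL false true false true true false (suc zero) = refl
  plusL false true false true true false (suc (suc zero)) = refl
  plusL false true false true true true zero = refl
  plusL false true false true true true (suc zero) = refl
  plusL false true false true true true (suc (suc zero)) = refl
  plusL false true true false false false zero = refl
  plusL false true true false false false (suc zero) = refl
  plusL false true true false false false (suc (suc zero)) = refl
  plusL false true true false false true zero = refl
  plusL false true true false false true (suc zero) = refl
  plusL false true true false false true (suc (suc zero)) = refl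
  plusL false true true false true false zero = refl
  plusL false true true false true false (suc zero) = refl
  plusL false true true false true false (suc (suc zero)) = refl
  plusL false true true false true true zero = refl
  plusL false true true false true true (suc zero) = refl
  plusL false true true false true true (suc (suc zero)) = refl
  plusL false true true true false false zero = refl
  plusL false true true true false false (suc zero) = refl
  plusL false true true true false false (suc (suc zero)) = refl
  plusL false true true true false true zero = refl
  plusL false true true true false true (suc zero) = refl
  plusL false true true true false true (suc (suc zero)) = refl
  plusL false true true true true false zero = refl
  plusL false true true true true false (suc zero) = refl
  plusL false true true true true false (suc (suc zero)) = refl
  plusL false true true true true true zero = refl
  plusL false true true true true true (suc zero) = refl
  plusL false true true true true true (suc (suc zero)) = refl
  plusL true false false false false false zero = refl
  plusL true false false false false false (suc zero) = refl
  plusL true false false false false false (suc (suc zero)) = refl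
  plusL true false false false false true zero = refl
  plusL true false false false false true (suc zero) = refl
  plusL true false false false false true (suc (suc zero)) = refl
  plusL true false false false true false zero = refl
  plusL true false false false true false (suc zero) = refl
  plusL true false false false true false (suc (suc zero)) = refl
  plusL true false false false true true zero = refl
  plusL true false false false true true (suc zero) = refl
  plusL true false false false true true (suc (suc zero)) = refl
  plusL true false false true false false zero = refl
  plusL true false false true false false (suc zero) = refl
  plusL true false false true false false (suc (suc zero)) = refl
  plusL true false false true false true zero = refl
  plusL true false false true false true (suc zero) = refl
  plusL true false false true false true (suc (suc zero)) = refl
  plusL true false false true true false zero = refl
  plusL true false false true true false (suc zero) = refl
  plusL true false false true true false (suc (suc zero)) = refl
  plusL true false false true true true zero = refl
  plusL true false false true true true (suc zero) = refl
  plusL true false false true true true (suc (suc zero)) = refl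
  plusL true false true false false false zero = refl
  plusL true false true false false false (suc zero) = refl
  plusL true false true false false false (suc (suc zero)) = refl
  plusL true false true false false true zero = refl
  plusL true false true false false true (suc zero) = refl
  plusL true false true false false true (suc (suc zero)) = refl
  plusL true false true false true false zero = refl
  plusL true false true false true false (suc zero) = refl
  plusL true false true false true false (suc (suc zero)) = refl
  plusL true false true false true true zero = refl
  plusL true false true false true true (suc zero) = refl
  plusL true false true false true true (suc (suc zero)) = refl
  plusL true false true true false false zero = refl
  plusL true false true true false false (suc zero) = refl
  plusL true false true true false false (suc (suc zero)) = refl
  plusL true false true true false true zero = refl
  plusL true false true true false true (suc zero) = refl
  plusL true false true true false true (suc (suc zero)) = refl
  plusL true false true true true false zero = refl
  plusL true false true true true false (suc zero) = refl
  plusL true false true true true false (suc (suc zero)) = refl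
  plusL true false true true true true zero = refl
  plusL true false true true true true (suc zero) = refl
  plusL true false true true true true (suc (suc zero)) = refl
  plusL true true false false false false zero = refl
  plusL true true false false false false (suc zero) = refl
  plusL true true false false false false (suc (suc zero)) = refl
  plusL true true false false false true zero = refl
  plusL true true false false false true (suc zero) = refl
  plusL true true false false false true (suc (suc zero)) = refl
  plusL true true false false true false zero = refl
  plusL true true false false true false (suc zero) = refl
  plusL true true false false true false (suc (suc zero)) = refl
  plusL true true false false true true zero = refl
  plusL true true false false true true (suc zero) = refl
  plusL true true false false true true (suc (suc zero)) = refl
  plusL true true false true false false zero = refl
  plusL true true false true false false (suc zero) = refl
  plusL true true false true false false (suc (suc zero)) = refl
  plusL true true false true false true zero = refl
  plusL true true false true false true (suc zero) = refl
  plusL true true false true false true (suc (suc zero)) = refl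
  plusL true true false true true false zero = refl
  plusL true true false true true false (suc zero) = refl
  plusL true true false true true false (suc (suc zero)) = refl
  plusL true true false true true true zero = refl
  plusL true true false true true true (suc zero) = refl
  plusL true true false true true true (suc (suc zero)) = refl
  plusL true true true false false false zero = refl
  plusL true true true false false false (suc zero) = refl
  plusL true true true false false false (suc (suc zero)) = refl
  plusL true true true false false true zero = refl
  plusL true true true false false true (suc zero) = refl
  plusL true true true false false true (suc (suc zero)) = refl
  plusL true true true false true false zero = refl
  plusL true true true false true false (suc zero) = refl
  plusL true true true false true false (suc (suc zero)) = refl
  plusL true true true false true true zero = refl
  plusL true true true false true true (suc zero) = refl
  plusL true true true false true true (suc (suc zero)) = refl
  plusL true true true true false false zero = refl
  plusL true true true true false false (suc zero) = refl
  plusL true true true true false false (suc (suc zero)) = refl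
  plusL true true true true false true zero = refl
  plusL true true true true false true (suc zero) = refl
  plusL true true true true false true (suc (suc zero)) = refl
  plusL true true true true true false zero = refl
  plusL true true true true true false (suc zero) = refl
  plusL true true true true true false (suc (suc zero)) = refl
  plusL true true true true true true zero = refl
  plusL true true true true true true (suc zero) = refl
  plusL true true true true true true (suc (suc zero)) = refl
  incrL : ∀ a b c i → (mk a b c i ∧ᵇ fF (mk a b c) i) ≡ mk a b c i
  incrL false false false zero = refl
  incrL false false false (suc zero) = refl
  incrL false false false (suc (suc zero)) = refl
  incrL false false true zero = refl
  incrL false false true (suc zero) = refl
  incrL false false true (suc (suc zero)) = refl
  incrL false true false zero = refl
  incrL false true false (suc zero) = refl
  incrL false true false (suc (suc zero)) = refl
  incrL false true true zero = refl
  incrL false true true (suc zero) = refl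
  incrL false true true (suc (suc zero)) = refl
  incrL true false false zero = refl
  incrL true false false (suc zero) = refl
  incrL true false false (suc (suc zero)) = refl
  incrL true false true zero = refl
  incrL true false true (suc zero) = refl
  incrL true false true (suc (suc zero)) = refl
  incrL true true false zero = refl
  incrL true true false (suc zero) = refl
  incrL true true false (suc (suc zero)) = refl
  incrL true true true zero = refl
  incrL true true true (suc zero) = refl
  incrL true true true (suc (suc zero)) = refl
  idemL : ∀ a b c i → (fF (fF (mk a b c)) i ∧ᵇ fF (mk a b c) i) ≡ fF (fF (mk a b c)) i
  idemL false false false zero = refl
  idemL false false false (suc zero) = refl
  idemL false false false (suc (suc zero)) = refl
  idemL false false true zero = refl
  idemL false false true (suc zero) = refl
  idemL false false true (suc (suc zero)) = refl
  idemL false true false zero = refl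
  idemL false true false (suc zero) = refl
  idemL false true false (suc (suc zero)) = refl
  idemL false true true zero = refl
  idemL false true true (suc zero) = refl
  idemL false true true (suc (suc zero)) = refl
  idemL true false false zero = refl
  idemL true false false (suc zero) = refl
  idemL true false false (suc (suc zero)) = refl
  idemL true false true zero = refl
  idemL true false true (suc zero) = refl
  idemL true false true (suc (suc zero)) = refl
  idemL true true false zero = refl
  idemL true true false (suc zero) = refl
  idemL true true false (suc (suc zero)) = refl
  idemL true true true zero = refl
  idemL true true true (suc zero) = refl
  idemL true true true (suc (suc zero)) = refl

open FForkFacts

B-F : ClosureAlgebra
B-F = record
  { ba = 𝒫₃
  ; f = fF
  ; f-cong = λ {X} {Y} p i → congL i (p zero) (p (suc zero)) (p (suc (suc zero)))
  ; f-⊥ = f⊥L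
  ; f-∨ = λ X Y i → plusL (X zero) (X (suc zero)) (X (suc (suc zero)))
                          (Y zero) (Y (suc zero)) (Y (suc (suc zero))) i
  ; f-incr = incr
  ; f-idem = λ X i → idemL (X zero) (X (suc zero)) (X (suc (suc zero))) i
  }
  where
    incr : ∀ X i → (X i ∧ᵇ fF X i) ≡ X i
    incr X zero = incrL (X zero) (X (suc zero)) (X (suc (suc zero))) zero
    incr X (suc zero) = incrL (X zero) (X (suc zero)) (X (suc (suc zero))) (suc zero)
    incr X (suc (suc zero)) = incrL (X zero) (X (suc zero)) (X (suc (suc zero))) (suc (suc zero))

data Term : Set where
  var      : ℕ → Term
  _∨ᵗ_ _∧ᵗ_ : Term → Term → Term
  ¬ᵗ_ fᵗ_  : Term → Term
  ⊤ᵗ ⊥ᵗ   : Term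

module _ (A : ClosureAlgebra) where
  open ClosureAlgebra A

  ⟦_⟧ : Term → (ℕ → Carrier) → Carrier
  ⟦ var n ⟧ ρ = ρ n
  ⟦ s ∨ᵗ t ⟧ ρ = ⟦ s ⟧ ρ ∨ ⟦ t ⟧ ρ
  ⟦ s ∧ᵗ t ⟧ ρ = ⟦ s ⟧ ρ ∧ ⟦ t ⟧ ρ
  ⟦ ¬ᵗ t ⟧ ρ = ¬ ⟦ t ⟧ ρ
  ⟦ fᵗ t ⟧ ρ = f (⟦ t ⟧ ρ)
  ⟦ ⊤ᵗ ⟧ ρ = ⊤
  ⟦ ⊥ᵗ ⟧ ρ = ⊥

  Satisfies : Term → Term → Set
  Satisfies s t = ∀ ρ → ⟦ s ⟧ ρ ≈ ⟦ t ⟧ ρ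

InEqBF : ClosureAlgebra → Set
InEqBF A = ∀ s t → Satisfies B-F s t → Satisfies A s t

record Hom (A B : ClosureAlgebra) : Set where
  private
    module A = ClosureAlgebra A
    module B = ClosureAlgebra B
  field
    ⟪_⟫   : A.Carrier → B.Carrier
    h-cong : ∀ {x y} → x A.≈ y → ⟪ x ⟫ B.≈ ⟪ y ⟫
    h-∨   : ∀ x y → ⟪ x A.∨ y ⟫ B.≈ (⟪ x ⟫ B.∨ ⟪ y ⟫)
    h-∧   : ∀ x y → ⟪ x A.∧ y ⟫ B.≈ (⟪ x ⟫ B.∧ ⟪ y ⟫)
    h-¬   : ∀ x → ⟪ A.¬ x ⟫ B.≈ (B.¬ ⟪ x ⟫)
    h-⊤   : ⟪ A.⊤ ⟫ B.≈ B.⊤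
    h-⊥   : ⟪ A.⊥ ⟫ B.≈ B.⊥
    h-f   : ∀ x → ⟪ A.f x ⟫ B.≈ B.f ⟪ x ⟫
open Hom public

Surjective : {A B : ClosureAlgebra} → Hom A B → Set
Surjective {A} {B} p = ∀ b → ∃ λ a → ⟪ p ⟫ a ≈ b
  where open ClosureAlgebra B

Injective : {A B : ClosureAlgebra} → Hom A B → Set
Injective {A} {B} p = ∀ x y → ⟪ p ⟫ x B.≈ ⟪ p ⟫ y → x A.≈ y
  where
    module A = ClosureAlgebra A
    module B = ClosureAlgebra B

_≅_ : ClosureAlgebra → ClosureAlgebra → Set
A ≅ B = Σ (Hom A B) λ h → Injective h × Surjective h

ProjectiveInEqBF : ClosureAlgebra → Set₁
ProjectiveInEqBF B = ∀ (A : ClosureAlgebra) → InEqBF A → (p : Hom A B) → Surjective p →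
  Σ (Hom B A) λ q → ∀ b → ⟪ p ⟫ (⟪ q ⟫ b) ≈ b
  where open ClosureAlgebra B

Finite : ClosureAlgebra → Set
Finite A = ∃ λ n → Σ (Fin n → Carrier) λ e → ∀ x → ∃ λ i → e i ≈ x
  where open ClosureAlgebra A

Nontrivial : ClosureAlgebra → Set
Nontrivial A = ∃ λ x → ∃ λ y → Not (x ≈ y)
  where open ClosureAlgebra A

DirectlyIndecomposable : ClosureAlgebra → Set₁
DirectlyIndecomposable B =
  Not (Σ ClosureAlgebra λ C → Σ ClosureAlgebra λ D →
       Nontrivial C × Nontrivial D × (B ≅ (C ×ᶜ D)))

{-# OPTIONS --safe #-}
module Submission where

open import Defs
open import Data.Product using (_×_)
open import Relation.Nullary using (¬_)

open import Function using (_∘_; case_of_)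
open import Data.Nat using (ℕ; suc; NonZero)
open import Data.Nat.DivMod using (_mod_; m<n⇒m%n≡m)
open import Data.Fin using (Fin; zero; suc; toℕ)
open import Data.Fin.Properties using (¬Fin0; toℕ-injective; toℕ-fromℕ<; toℕ<n)
open import Data.Bool using (true; false; not) renaming (_∨_ to _∨ᵇ_; _∧_ to _∧ᵇ_)
open import Data.Bool.Properties using (∨-identityʳ; ∨-zeroʳ; ¬-not)
open import Data.Product using (Σ; ∃; _,_; proj₁; proj₂; map)
open import Data.Sum using (_⊎_; inj₁; inj₂; [_,_]′)
open import Data.Empty using (⊥-elim)
open import Relation.Binary.PropositionalEquality as ≡ using (_≡_; refl; cong; cong₂)
import Algebra.Lattice.Properties.BooleanAlgebra as BooleanAlgebraProperties
import Relation.Binary.Reasoning.Setoid as SetoidReasoning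

-- Finiteness makes B a homomorphic image of the free algebra of Eq(B_F) on
-- countably many generators, and projectivity splits this surjection, so B is
-- a retract of the free algebra.  Connectedness (every clopen element is 0 or 1)
-- and "the closures of two non-closed elements meet" pass to retracts, and
-- connectedness rules out a nontrivial product decomposition.  In the free
-- algebra both properties come from the fork: at the maximal points v and w the
-- value of a term only depends on the values of its variables at that point.
-- Hence a clopen term, whose values are constant on the connected fork, takes
-- the same constant value in all valuations; and witnesses of non-closedness
-- of two terms can be glued at v and w, both of which are seen from u.

module _ (A : ClosureAlgebra) where
  private
    module A = ClosureAlgebra A
  open BooleanAlgebraProperties A.ba using (∧-identityˡ; ∧-identityʳ; ∧-zeroʳ; ¬⊤≈⊥; ¬⊥≈⊤)
  open SetoidReasoning A.setoid

  Clopen : A.Carrier → Set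
  Clopen c = A.Closed c × A.Closed (A.¬ c)

  Connected : Set
  Connected = ∀ c → Clopen c → (c A.≈ A.⊤) ⊎ (c A.≈ A.⊥)

  NonClosedClosuresMeet : Set
  NonClosedClosuresMeet =
    ∀ a b → ¬ A.Closed a → ¬ A.Closed b → ¬ ((A.f a A.∧ A.f b) A.≈ A.⊥)

  Closed-resp-≈ : ∀ {x y} → x A.≈ y → A.Closed x → A.Closed y
  Closed-resp-≈ x≈y fx≈x = A.trans (A.f-cong (A.sym x≈y)) (A.trans fx≈x x≈y)

  Clopen-resp-≈ : ∀ {x y} → x A.≈ y → Clopen x → Clopen y
  Clopen-resp-≈ x≈y (closed , coclosed) =
    Closed-resp-≈ x≈y closed , Closed-resp-≈ (A.¬-cong x≈y) coclosed

  f-⊤ : A.f A.⊤ A.≈ A.⊤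
  f-⊤ = A.trans (A.sym (∧-identityˡ (A.f A.⊤))) (A.f-incr A.⊤)

  ⊤-clopen : Clopen A.⊤
  ⊤-clopen = f-⊤ , Closed-resp-≈ (A.sym ¬⊤≈⊥) A.f-⊥

  ⊥-clopen : Clopen A.⊥
  ⊥-clopen = A.f-⊥ , Closed-resp-≈ (A.sym ¬⊥≈⊤) f-⊤

  ⊤≈⊥⇒¬nontrivial : A.⊤ A.≈ A.⊥ → ¬ Nontrivial A
  ⊤≈⊥⇒¬nontrivial ⊤≈⊥ (x , y , x≉y) = x≉y (A.trans (≈⊥ x) (A.sym (≈⊥ y)))
    where
      ≈⊥ : ∀ z → z A.≈ A.⊥
      ≈⊥ z = begin
        z          ≈⟨ ∧-identityʳ z ⟨
        z A.∧ A.⊤  ≈⟨ A.∧-cong A.refl ⊤≈⊥ ⟩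
        z A.∧ A.⊥  ≈⟨ ∧-zeroʳ z ⟩
        A.⊥        ∎

Clopen-× : ∀ C D {x y} → Clopen C x → Clopen D y → Clopen (C ×ᶜ D) (x , y)
Clopen-× C D (x-closed , x-coclosed) (y-closed , y-coclosed) =
  (x-closed , y-closed) , (x-coclosed , y-coclosed)

module _ {A B : ClosureAlgebra} (h : Hom A B) where
  private
    module A = ClosureAlgebra A
    module B = ClosureAlgebra B

  Hom-preserves-Closed : ∀ {x} → A.Closed x → B.Closed (⟪ h ⟫ x)
  Hom-preserves-Closed fx≈x = B.trans (B.sym (h-f h _)) (h-cong h fx≈x)

  Hom-preserves-Clopen : ∀ {x} → Clopen A x → Clopen B (⟪ h ⟫ x)
  Hom-preserves-Clopen (closed , coclosed) =
    Hom-preserves-Closed closed , Closed-resp-≈ B (h-¬ h _) (Hom-preserves-Closed coclosed)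

  Injective-reflects-Closed : Injective h → ∀ {x} → B.Closed (⟪ h ⟫ x) → A.Closed x
  Injective-reflects-Closed injective closed = injective _ _ (B.trans (h-f h _) closed)

  Injective-reflects-Clopen : Injective h → ∀ {x} → Clopen B (⟪ h ⟫ x) → Clopen A x
  Injective-reflects-Clopen injective (closed , coclosed) =
      Injective-reflects-Closed injective closed
    , Injective-reflects-Closed injective (Closed-resp-≈ B (B.sym (h-¬ h _)) coclosed)

module _ {A B : ClosureAlgebra} (p : Hom A B) (q : Hom B A)
         (p∘q≈id : ∀ b → ClosureAlgebra._≈_ B (⟪ p ⟫ (⟪ q ⟫ b)) b) where
  private
    module A = ClosureAlgebra A
    module B = ClosureAlgebra B

  section-reflects-Closed : ∀ {b} → A.Closed (⟪ q ⟫ b) → B.Closed b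
  section-reflects-Closed closed = Closed-resp-≈ B (p∘q≈id _) (Hom-preserves-Closed p closed)

  Connected-retract : Connected A → Connected B
  Connected-retract connected c clopen with connected (⟪ q ⟫ c) (Hom-preserves-Clopen q clopen)
  ... | inj₁ qc≈⊤ = inj₁ (B.trans (B.sym (p∘q≈id c)) (B.trans (h-cong p qc≈⊤) (h-⊤ p)))
  ... | inj₂ qc≈⊥ = inj₂ (B.trans (B.sym (p∘q≈id c)) (B.trans (h-cong p qc≈⊥) (h-⊥ p)))

  NonClosedClosuresMeet-retract : NonClosedClosuresMeet A → NonClosedClosuresMeet B
  NonClosedClosuresMeet-retract meet a b a-open b-open fa∧fb≈⊥ =
    meet (⟪ q ⟫ a) (⟪ q ⟫ b) (a-open ∘ section-reflects-Closed) (b-open ∘ section-reflects-Closed)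
      (begin
        A.f (⟪ q ⟫ a) A.∧ A.f (⟪ q ⟫ b)        ≈⟨ A.∧-cong (h-f q a) (h-f q b) ⟨
        ⟪ q ⟫ (B.f a) A.∧ ⟪ q ⟫ (B.f b)        ≈⟨ h-∧ q (B.f a) (B.f b) ⟨
        ⟪ q ⟫ (B.f a B.∧ B.f b)                ≈⟨ h-cong q fa∧fb≈⊥ ⟩
        ⟪ q ⟫ B.⊥                              ≈⟨ h-⊥ q ⟩
        A.⊥                                    ∎)
    where open SetoidReasoning A.setoid

connected⇒indecomposable : (B : ClosureAlgebra) → Connected B → DirectlyIndecomposable B
connected⇒indecomposable B connected (C , D , C-nontrivial , D-nontrivial , h , h-injective , h-surjective) =
  [ (λ e≈⊤ → ⊤≈⊥⇒¬nontrivial D (proj₂ (⊤⊤≈⊤⊥ e≈⊤)) D-nontrivial)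
  , (λ e≈⊥ → ⊤≈⊥⇒¬nontrivial C (proj₁ (⊤⊥≈⊥⊥ e≈⊥)) C-nontrivial)
  ]′ (connected e e-clopen)
  where
    module B = ClosureAlgebra B
    module C = ClosureAlgebra C
    module D = ClosureAlgebra D
    module CD = ClosureAlgebra (C ×ᶜ D)
    e : B.Carrier
    e = proj₁ (h-surjective (C.⊤ , D.⊥))
    he≈⊤⊥ : ⟪ h ⟫ e CD.≈ (C.⊤ , D.⊥)
    he≈⊤⊥ = proj₂ (h-surjective (C.⊤ , D.⊥))
    e-clopen : Clopen B e
    e-clopen = Injective-reflects-Clopen h h-injective
      (Clopen-resp-≈ (C ×ᶜ D) (CD.sym he≈⊤⊥) (Clopen-× C D (⊤-clopen C) (⊥-clopen D)))
    ⊤⊤≈⊤⊥ : e B.≈ B.⊤ → (C.⊤ , D.⊤) CD.≈ (C.⊤ , D.⊥)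
    ⊤⊤≈⊤⊥ e≈⊤ = CD.trans (CD.sym (h-⊤ h)) (CD.trans (h-cong h (B.sym e≈⊤)) he≈⊤⊥)
    ⊤⊥≈⊥⊥ : e B.≈ B.⊥ → (C.⊤ , D.⊥) CD.≈ (C.⊥ , D.⊥)
    ⊤⊥≈⊥⊥ e≈⊥ = CD.trans (CD.sym he≈⊤⊥) (CD.trans (h-cong h e≈⊥) (h-⊥ h))

toℕ-mod : ∀ {n} .{{_ : NonZero n}} (i : Fin n) → toℕ i mod n ≡ i
toℕ-mod i = toℕ-injective (≡.trans (toℕ-fromℕ< _) (m<n⇒m%n≡m (toℕ<n i)))

finite⇒ℕ-surjection : (A : ClosureAlgebra) → Finite A →
  Σ (ℕ → ClosureAlgebra.Carrier A) λ ρ → ∀ x → ∃ λ n → ClosureAlgebra._≈_ A (ρ n) x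
finite⇒ℕ-surjection A (ℕ.zero , e , onto) = ⊥-elim (¬Fin0 (proj₁ (onto (ClosureAlgebra.⊤ A))))
finite⇒ℕ-surjection A (suc m , e , onto) =
  (λ k → e (k mod suc m)) ,
  λ x → map toℕ (λ {i} → ≡.subst (λ j → ClosureAlgebra._≈_ A (e j) x) (≡.sym (toℕ-mod i))) (onto x)

module _ (K : ClosureAlgebra) where
  private
    module K = ClosureAlgebra K

    ⟦_⟧ₖ : Term → (ℕ → K.Carrier) → K.Carrier
    ⟦_⟧ₖ = ⟦_⟧ K

  -- Terms modulo the equations of K: the free algebra of Eq(K) on the
  -- generators var n.  Evaluating a term in it is substitution.
  FreeAlgebra : ClosureAlgebra
  FreeAlgebra = record
    { ba = record
      { Carrier = Term
      ; _≈_ = Satisfies K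
      ; _∨_ = _∨ᵗ_
      ; _∧_ = _∧ᵗ_
      ; ¬_ = ¬ᵗ_
      ; ⊤ = ⊤ᵗ
      ; ⊥ = ⊥ᵗ
      ; isBooleanAlgebra = record
        { isDistributiveLattice = record
          { isLattice = record
            { isEquivalence = record
              { refl = λ ρ → K.refl
              ; sym = λ s≈t ρ → K.sym (s≈t ρ)
              ; trans = λ s≈t t≈r ρ → K.trans (s≈t ρ) (t≈r ρ)
              }
            ; ∨-comm = λ s t ρ → K.∨-comm (⟦ s ⟧ₖ ρ) (⟦ t ⟧ₖ ρ)
            ; ∨-assoc = λ s t r ρ → K.∨-assoc (⟦ s ⟧ₖ ρ) (⟦ t ⟧ₖ ρ) (⟦ r ⟧ₖ ρ)
            ; ∨-cong = λ s≈s′ t≈t′ ρ → K.∨-cong (s≈s′ ρ) (t≈t′ ρ)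
            ; ∧-comm = λ s t ρ → K.∧-comm (⟦ s ⟧ₖ ρ) (⟦ t ⟧ₖ ρ)
            ; ∧-assoc = λ s t r ρ → K.∧-assoc (⟦ s ⟧ₖ ρ) (⟦ t ⟧ₖ ρ) (⟦ r ⟧ₖ ρ)
            ; ∧-cong = λ s≈s′ t≈t′ ρ → K.∧-cong (s≈s′ ρ) (t≈t′ ρ)
            ; absorptive = (λ s t ρ → K.∨-absorbs-∧ (⟦ s ⟧ₖ ρ) (⟦ t ⟧ₖ ρ))
                         , (λ s t ρ → K.∧-absorbs-∨ (⟦ s ⟧ₖ ρ) (⟦ t ⟧ₖ ρ))
            }
          ; ∨-distrib-∧ = (λ s t r ρ → K.∨-distribˡ-∧ (⟦ s ⟧ₖ ρ) (⟦ t ⟧ₖ ρ) (⟦ r ⟧ₖ ρ))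
                        , (λ s t r ρ → K.∨-distribʳ-∧ (⟦ s ⟧ₖ ρ) (⟦ t ⟧ₖ ρ) (⟦ r ⟧ₖ ρ))
          ; ∧-distrib-∨ = (λ s t r ρ → K.∧-distribˡ-∨ (⟦ s ⟧ₖ ρ) (⟦ t ⟧ₖ ρ) (⟦ r ⟧ₖ ρ))
                        , (λ s t r ρ → K.∧-distribʳ-∨ (⟦ s ⟧ₖ ρ) (⟦ t ⟧ₖ ρ) (⟦ r ⟧ₖ ρ))
          }
        ; ∨-complement = (λ s ρ → K.∨-complementˡ (⟦ s ⟧ₖ ρ)) , (λ s ρ → K.∨-complementʳ (⟦ s ⟧ₖ ρ))
        ; ∧-complement = (λ s ρ → K.∧-complementˡ (⟦ s ⟧ₖ ρ)) , (λ s ρ → K.∧-complementʳ (⟦ s ⟧ₖ ρ))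
        ; ¬-cong = λ s≈t ρ → K.¬-cong (s≈t ρ)
        }
      }
    ; f = fᵗ_
    ; f-cong = λ s≈t ρ → K.f-cong (s≈t ρ)
    ; f-⊥ = λ ρ → K.f-⊥
    ; f-∨ = λ s t ρ → K.f-∨ (⟦ s ⟧ₖ ρ) (⟦ t ⟧ₖ ρ)
    ; f-incr = λ s ρ → K.f-incr (⟦ s ⟧ₖ ρ)
    ; f-idem = λ s ρ → K.f-idem (⟦ s ⟧ₖ ρ)
    }

  ⟦⟧-subst : ∀ s σ ρ → ⟦ ⟦_⟧ FreeAlgebra s σ ⟧ₖ ρ K.≈ ⟦ s ⟧ₖ (λ n → ⟦ σ n ⟧ₖ ρ)
  ⟦⟧-subst (var n) σ ρ = K.refl
  ⟦⟧-subst (s ∨ᵗ t) σ ρ = K.∨-cong (⟦⟧-subst s σ ρ) (⟦⟧-subst t σ ρ)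
  ⟦⟧-subst (s ∧ᵗ t) σ ρ = K.∧-cong (⟦⟧-subst s σ ρ) (⟦⟧-subst t σ ρ)
  ⟦⟧-subst (¬ᵗ s) σ ρ = K.¬-cong (⟦⟧-subst s σ ρ)
  ⟦⟧-subst (fᵗ s) σ ρ = K.f-cong (⟦⟧-subst s σ ρ)
  ⟦⟧-subst ⊤ᵗ σ ρ = K.refl
  ⟦⟧-subst ⊥ᵗ σ ρ = K.refl

  FreeAlgebra-satisfies : ∀ s t → Satisfies K s t → Satisfies FreeAlgebra s t
  FreeAlgebra-satisfies s t s≈t σ ρ =
    K.trans (⟦⟧-subst s σ ρ) (K.trans (s≈t _) (K.sym (⟦⟧-subst t σ ρ)))

  module _ (A : ClosureAlgebra) (A-satisfies : ∀ s t → Satisfies K s t → Satisfies A s t)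
           (ρ : ℕ → ClosureAlgebra.Carrier A) where
    private
      module A = ClosureAlgebra A

    evalHom : Hom FreeAlgebra A
    evalHom = record
      { ⟪_⟫ = λ t → ⟦_⟧ A t ρ
      ; h-cong = λ {s} {t} s≈t → A-satisfies s t s≈t ρ
      ; h-∨ = λ s t → A.refl
      ; h-∧ = λ s t → A.refl
      ; h-¬ = λ s → A.refl
      ; h-⊤ = A.refl
      ; h-⊥ = A.refl
      ; h-f = λ s → A.refl
      }

    evalHom-surjective : (∀ x → ∃ λ n → ρ n A.≈ x) → Surjective evalHom
    evalHom-surjective onto x = map var (λ ρn≈x → ρn≈x) (onto x)

⟦_⟧ᶠ : Term → (ℕ → Subset3) → Subset3
⟦_⟧ᶠ = ⟦_⟧ B-F

data Maximal : Point → Set where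
  v-maximal : Maximal v
  w-maximal : Maximal w

fF-maximal : ∀ {i} → Maximal i → ∀ X → fF X i ≡ X i
fF-maximal v-maximal X = ∨-identityʳ (X v)
fF-maximal w-maximal X = ∨-identityʳ (X w)

module _ {i j} (i-max : Maximal i) (j-max : Maximal j) (ρ ρ′ : ℕ → Subset3)
         (ρi≡ρ′j : ∀ n → ρ n i ≡ ρ′ n j) where

  ⟦⟧ᶠ-cong-at-maximal : ∀ t → ⟦ t ⟧ᶠ ρ i ≡ ⟦ t ⟧ᶠ ρ′ j
  ⟦⟧ᶠ-cong-at-maximal (var n) = ρi≡ρ′j n
  ⟦⟧ᶠ-cong-at-maximal (s ∨ᵗ t) = cong₂ _∨ᵇ_ (⟦⟧ᶠ-cong-at-maximal s) (⟦⟧ᶠ-cong-at-maximal t)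
  ⟦⟧ᶠ-cong-at-maximal (s ∧ᵗ t) = cong₂ _∧ᵇ_ (⟦⟧ᶠ-cong-at-maximal s) (⟦⟧ᶠ-cong-at-maximal t)
  ⟦⟧ᶠ-cong-at-maximal (¬ᵗ s) = cong not (⟦⟧ᶠ-cong-at-maximal s)
  ⟦⟧ᶠ-cong-at-maximal (fᵗ s) = begin
    fF (⟦ s ⟧ᶠ ρ) i   ≡⟨ fF-maximal i-max (⟦ s ⟧ᶠ ρ) ⟩
    ⟦ s ⟧ᶠ ρ i        ≡⟨ ⟦⟧ᶠ-cong-at-maximal s ⟩
    ⟦ s ⟧ᶠ ρ′ j       ≡⟨ fF-maximal j-max (⟦ s ⟧ᶠ ρ′) ⟨
    fF (⟦ s ⟧ᶠ ρ′) j  ∎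
    where open ≡.≡-Reasoning
  ⟦⟧ᶠ-cong-at-maximal ⊤ᵗ = refl
  ⟦⟧ᶠ-cong-at-maximal ⊥ᵗ = refl

u∈fF : ∀ X i → X i ≡ true → fF X u ≡ true
u∈fF X zero Xu≡true rewrite Xu≡true = refl
u∈fF X (suc zero) Xv≡true rewrite Xv≡true = ∨-zeroʳ (X u)
u∈fF X (suc (suc zero)) Xw≡true rewrite Xw≡true | ∨-zeroʳ (X v) = ∨-zeroʳ (X u)

clopen-at-u⇒constant : ∀ a b c → a ∨ᵇ (b ∨ᵇ (c ∨ᵇ false)) ≡ a →
  not a ∨ᵇ (not b ∨ᵇ (not c ∨ᵇ false)) ≡ not a → (a ≡ c) × (b ≡ c)
clopen-at-u⇒constant false false false _ _ = refl , refl
clopen-at-u⇒constant false false true () _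
clopen-at-u⇒constant false true  false () _
clopen-at-u⇒constant false true  true () _
clopen-at-u⇒constant true  false false _ ()
clopen-at-u⇒constant true  false true _ ()
clopen-at-u⇒constant true  true  false _ ()
clopen-at-u⇒constant true  true  true _ _ = refl , refl

clopen⇒constant : ∀ X → Clopen B-F X → ∀ i → X i ≡ X w
clopen⇒constant X (closed , coclosed) zero =
  proj₁ (clopen-at-u⇒constant (X u) (X v) (X w) (closed u) (coclosed u))
clopen⇒constant X (closed , coclosed) (suc zero) =
  proj₂ (clopen-at-u⇒constant (X u) (X v) (X w) (closed u) (coclosed u))
clopen⇒constant X _ (suc (suc zero)) = refl

FreeForkAlgebra : ClosureAlgebra
FreeForkAlgebra = FreeAlgebra B-F

constant⇒⊤⊎⊥ : ∀ t c → (∀ ρ i → ⟦ t ⟧ᶠ ρ i ≡ c) → Satisfies B-F t ⊤ᵗ ⊎ Satisfies B-F t ⊥ᵗ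
constant⇒⊤⊎⊥ t true  t≡true  = inj₁ t≡true
constant⇒⊤⊎⊥ t false t≡false = inj₂ t≡false

FreeForkAlgebra-connected : Connected FreeForkAlgebra
FreeForkAlgebra-connected t (closed , coclosed) = constant⇒⊤⊎⊥ t (⟦ t ⟧ᶠ ρ₀ v) ≡value-at-ρ₀
  where
    open ≡.≡-Reasoning
    ρ₀ : ℕ → Subset3
    ρ₀ _ _ = false
    constant : ∀ ρ i → ⟦ t ⟧ᶠ ρ i ≡ ⟦ t ⟧ᶠ ρ w
    constant ρ = clopen⇒constant (⟦ t ⟧ᶠ ρ) (closed ρ , coclosed ρ)
    -- ρ at w is transported to ρw, which agrees with ρ₀ at v.
    ≡value-at-ρ₀ : ∀ ρ i → ⟦ t ⟧ᶠ ρ i ≡ ⟦ t ⟧ᶠ ρ₀ v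
    ≡value-at-ρ₀ ρ i = begin
      ⟦ t ⟧ᶠ ρ i   ≡⟨ constant ρ i ⟩
      ⟦ t ⟧ᶠ ρ w   ≡⟨ ⟦⟧ᶠ-cong-at-maximal w-maximal w-maximal ρ ρw (λ _ → refl) t ⟩
      ⟦ t ⟧ᶠ ρw w  ≡⟨ constant ρw v ⟨
      ⟦ t ⟧ᶠ ρw v  ≡⟨ ⟦⟧ᶠ-cong-at-maximal v-maximal v-maximal ρw ρ₀ (λ _ → refl) t ⟩
      ⟦ t ⟧ᶠ ρ₀ v  ∎
      where
        ρw : ℕ → Subset3
        ρw n = FForkFacts.mk false false (ρ n w)

closed-if-false-at-maximal : ∀ t → (∀ {i} → Maximal i → ∀ ρ → ¬ ⟦ t ⟧ᶠ ρ i ≡ true) →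
  ClosureAlgebra.Closed FreeForkAlgebra t
closed-if-false-at-maximal t false-at ρ zero
  rewrite ¬-not (false-at v-maximal ρ) | ¬-not (false-at w-maximal ρ) = ∨-identityʳ (⟦ t ⟧ᶠ ρ u)
closed-if-false-at-maximal t _ ρ (suc zero) = fF-maximal v-maximal (⟦ t ⟧ᶠ ρ)
closed-if-false-at-maximal t _ ρ (suc (suc zero)) = fF-maximal w-maximal (⟦ t ⟧ᶠ ρ)

closures-meet-at-u : ∀ x y {i j} → Maximal i → Maximal j → ∀ ρ ρ′ →
  ⟦ x ⟧ᶠ ρ i ≡ true → ⟦ y ⟧ᶠ ρ′ j ≡ true → ¬ Satisfies B-F ((fᵗ x) ∧ᵗ (fᵗ y)) ⊥ᵗ
closures-meet-at-u x y {i} {j} i-max j-max ρ ρ′ x-true y-true disjoint =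
  case ≡.trans (≡.sym both-at-u) (disjoint glued u) of λ ()
  where
    -- x keeps its value at v, y at w; u sees both.
    glued : ℕ → Subset3
    glued n = FForkFacts.mk false (ρ n i) (ρ′ n j)
    x-at-v : ⟦ x ⟧ᶠ glued v ≡ true
    x-at-v = ≡.trans (⟦⟧ᶠ-cong-at-maximal v-maximal i-max glued ρ (λ _ → refl) x) x-true
    y-at-w : ⟦ y ⟧ᶠ glued w ≡ true
    y-at-w = ≡.trans (⟦⟧ᶠ-cong-at-maximal w-maximal j-max glued ρ′ (λ _ → refl) y) y-true
    both-at-u : fF (⟦ x ⟧ᶠ glued) u ∧ᵇ fF (⟦ y ⟧ᶠ glued) u ≡ true
    both-at-u = cong₂ _∧ᵇ_ (u∈fF (⟦ x ⟧ᶠ glued) v x-at-v) (u∈fF (⟦ y ⟧ᶠ glued) w y-at-w)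

FreeForkAlgebra-closuresMeet : NonClosedClosuresMeet FreeForkAlgebra
FreeForkAlgebra-closuresMeet x y x-open y-open disjoint =
  x-open (closed-if-false-at-maximal x λ i-max ρ x-true →
  y-open (closed-if-false-at-maximal y λ j-max ρ′ y-true →
  closures-meet-at-u x y i-max j-max ρ ρ′ x-true y-true disjoint))

mainTheorem7 : (B : ClosureAlgebra) → InEqBF B → Finite B → ProjectiveInEqBF B →
    DirectlyIndecomposable B ×
    (∀ a b → ClosureAlgebra.Atom B a → ¬ ClosureAlgebra.Closed B a →
             ClosureAlgebra.Atom B b → ¬ ClosureAlgebra.Closed B b →
             ¬ ClosureAlgebra._≈_ B (ClosureAlgebra._∧_ B (ClosureAlgebra.f B a) (ClosureAlgebra.f B b)) (ClosureAlgebra.⊥ B))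
mainTheorem7 B B∈EqBF finite projective =
    connected⇒indecomposable B (Connected-retract p q p∘q≈id FreeForkAlgebra-connected)
  , λ a b _ a-open _ b-open →
      NonClosedClosuresMeet-retract p q p∘q≈id FreeForkAlgebra-closuresMeet a b a-open b-open
  where
    ρ : ℕ → ClosureAlgebra.Carrier B
    ρ = proj₁ (finite⇒ℕ-surjection B finite)
    p : Hom FreeForkAlgebra B
    p = evalHom B-F B B∈EqBF ρ
    p-surjective : Surjective p
    p-surjective = evalHom-surjective B-F B B∈EqBF ρ (proj₂ (finite⇒ℕ-surjection B finite))
    q : Hom B FreeForkAlgebra
    q = proj₁ (projective FreeForkAlgebra (FreeAlgebra-satisfies B-F) p p-surjective)
    p∘q≈id : ∀ b → ClosureAlgebra._≈_ B (⟪ p ⟫ (⟪ q ⟫ b)) b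
    p∘q≈id = proj₂ (projective FreeForkAlgebra (FreeAlgebra-satisfies B-F) p p-surjective)
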